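{- Let $A\subseteq 2^\omega$, let $Y\subseteq 2^\omega$ be countable, let $p\in\mathbb{P}(A)$ and $q\in\mathbb{P}(A)_Y$. Let $r=p\setminus\{\text{``}x\in\bigcap_{m<\omega}U_{nm}\text{''}: x\notin Y,\ n<\omega\}$. Then $p$ and $q$ are compatible iff $r$ and $q$ are compatible.
   Context: For $A\subseteq 2^\omega$, $\mathbb{P}(A)$ is the set of finite sets $p$ of formal sentences of the following three kinds: (i) $\text{``}x\in\bigcap_{m<\omega}U_{nm}\text{''}$ with $x\in A$, $n\in\omega$; (ii) $\text{``}x\notin U_{nm}\text{''}$ with $x\in 2^\omega$, $n,m\in\omega$; (iii) $\text{``}[s]\subseteq U_{nm}\text{''}$ with $s\in 2^{<\omega}$, $n,m\in\omega$; such that $p$ is consistent, meaning: $p$ does not contain both $\text{``}x\in\bigcap_{m<\omega}U_{nm}\text{''}$ and $\text{``}x\notin U_{nk}\text{''}$ for any $x,n,k$, and $p$ does not contain both $\text{``}x\notin U_{nm}\text{''}$ and $\text{``}[x\upharpoonright k]\subseteq U_{nm}\text{''}$ for any $x,n,m,k$. The order is $p\leq q$ iff $p\supseteq q$; $p,q$ are compatible iff $p\cup q\in\mathbb{P}(A)$. For countable $Y\subseteq 2^\omega$, $\mathbb{P}(A)_Y$ is the set of $p\in\mathbb{P}(A)$ such that whenever $\text{``}x\notin U_{nk}\text{''}\in p$ or $\text{``}x\in\bigcap_{m<\omega}U_{nm}\text{''}\in p$, we have $x\in Y$. -}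

module Defs where

open import Data.Nat using (ℕ; zero; suc)
open import Data.Bool using (Bool)
open import Data.List using (List; []; _∷_; _++_)
open import Data.List.Membership.Propositional using (_∈_)
open import Data.Product using (Σ; _×_)
open import Data.Unit using (⊤)
open import Relation.Nullary using (¬_)
open import Relation.Binary.PropositionalEquality using (_≡_; _≗_)

Cantor : Set
Cantor = ℕ → Bool

BinStr : Set
BinStr = List Bool

Prefix : BinStr → Cantor → Set
Prefix []      x = ⊤
Prefix (b ∷ s) x = (b ≡ x 0) × Prefix s (λ i → x (suc i))

-- Subsets of 2^ω are predicates; as sets they respect (pointwise) equality of reals
Extensional : (Cantor → Set) → Set
Extensional B = ∀ x y → x ≗ y → B x → B y

Countable : (Cantor → Set) → Set
Countable Y = Σ ((x : Cantor) → Y x → ℕ) λ f →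
  ∀ x y (hx : Y x) (hy : Y y) → f x hx ≡ f y hy → x ≗ y

data Sentence : Set where
  inAll  : Cantor → ℕ → Sentence          -- "x ∈ ⋂_m U_{nm}"
  notIn  : Cantor → ℕ → ℕ → Sentence      -- "x ∉ U_{nm}"
  subU   : BinStr → ℕ → ℕ → Sentence      -- "[s] ⊆ U_{nm}"

Consistent : List Sentence → Set
Consistent p =
  (∀ x n y k → inAll x n ∈ p → notIn y n k ∈ p → ¬ (x ≗ y)) ×
  (∀ x n m s → notIn x n m ∈ p → subU s n m ∈ p → ¬ Prefix s x)

InP : (Cantor → Set) → List Sentence → Set
InP A p = (∀ x n → inAll x n ∈ p → A x) × Consistent p

InPY : (Cantor → Set) → (Cantor → Set) → List Sentence → Set
InPY A Y p = InP A p ×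
  ((∀ x n k → notIn x n k ∈ p → Y x) × (∀ x n → inAll x n ∈ p → Y x))

Compatible : (Cantor → Set) → List Sentence → List Sentence → Set
Compatible A p q = InP A (p ++ q)

Kept : (Cantor → Set) → Sentence → Set
Kept Y (inAll x n)   = Y x
Kept Y (notIn x n m) = ⊤
Kept Y (subU s n m)  = ⊤

module Submission where

open import Defs
open import Data.List using (List; _++_)
open import Data.List.Membership.Propositional using (_∈_)
open import Data.List.Membership.Propositional.Properties using (∈-++⁺ˡ; ∈-++⁺ʳ; ∈-++⁻)
open import Data.List.Relation.Binary.Subset.Propositional using (_⊆_)
open import Data.List.Relation.Binary.Subset.Propositional.Properties using (++⁺ˡ)
open import Data.Product using (_×_; _,_; proj₁; proj₂)
open import Data.Sum using (inj₁; inj₂)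
open import Data.Unit using (tt)
open import Function.Bundles using (_⇔_; mk⇔; Equivalence)
open import Relation.Binary.PropositionalEquality using (sym; _≗_)
open import Relation.Nullary using (¬_)

-- The two conditions differ only in the sentences "x ∈ ⋂ U_{nm}" with x ∉ Y.
-- Such a sentence can only clash with some "y ∉ U_{nk}" with y ≗ x; that
-- sentence cannot come from q (its points lie in Y, and Y is extensional),
-- and it cannot come from p (p is consistent).

InP-⊆ : ∀ {A p p′} → p ⊆ p′ → InP A p′ → InP A p
InP-⊆ p⊆p′ (inA , clash₁ , clash₂) =
  (λ x n m → inA x n (p⊆p′ m)) ,
  (λ x n y k m₁ m₂ → clash₁ x n y k (p⊆p′ m₁) (p⊆p′ m₂)) ,
  (λ x n m s m₁ m₂ → clash₂ x n m s (p⊆p′ m₁) (p⊆p′ m₂))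

inAll-++⇒A : ∀ {A p q} → InP A p → InP A q → ∀ x n → inAll x n ∈ p ++ q → A x
inAll-++⇒A {p = p} hp hq x n m with ∈-++⁻ p m
... | inj₁ m∈p = proj₁ hp x n m∈p
... | inj₂ m∈q = proj₁ hq x n m∈q

module _ {Y : Cantor → Set} {p r : List Sentence}
         (r⇔ : ∀ s → s ∈ r ⇔ (s ∈ p × Kept Y s)) where

  r⊆p : r ⊆ p
  r⊆p m = proj₁ (Equivalence.to (r⇔ _) m)

  Kept-∈-++ : ∀ q {s} → s ∈ p ++ q → Kept Y s → s ∈ r ++ q
  Kept-∈-++ q m kept with ∈-++⁻ p m
  ... | inj₁ m∈p = ∈-++⁺ˡ (Equivalence.from (r⇔ _) (m∈p , kept))
  ... | inj₂ m∈q = ∈-++⁺ʳ r m∈q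

  module _ {A : Cantor → Set} {q : List Sentence} (EY : Extensional Y)
           (hp : InP A p) (hq : InPY A Y q) where

    inAll-notIn-++ : Consistent (r ++ q) →
      ∀ x n y k → inAll x n ∈ p ++ q → notIn y n k ∈ p ++ q → ¬ (x ≗ y)
    inAll-notIn-++ (clash₁ , _) x n y k m₁ m₂ x≗y with ∈-++⁻ p m₁ | ∈-++⁻ p m₂
    ... | inj₂ m₁∈q | _ = clash₁ x n y k (∈-++⁺ʳ r m₁∈q) (Kept-∈-++ q m₂ tt) x≗y
    ... | inj₁ m₁∈p | inj₁ m₂∈p = proj₁ (proj₂ hp) x n y k m₁∈p m₂∈p x≗y
    ... | inj₁ m₁∈p | inj₂ m₂∈q =
      clash₁ x n y k (Kept-∈-++ q (∈-++⁺ˡ m₁∈p) x∈Y) (∈-++⁺ʳ r m₂∈q) x≗y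
      where
      x∈Y : Y x
      x∈Y = EY y x (λ i → sym (x≗y i)) (proj₁ (proj₂ hq) y n k m₂∈q)

    Compatible-restore : Compatible A r q → Compatible A p q
    Compatible-restore (_ , consistent@(_ , clash₂)) =
      inAll-++⇒A hp (proj₁ hq) ,
      inAll-notIn-++ consistent ,
      (λ x n m s m₁ m₂ → clash₂ x n m s (Kept-∈-++ q m₁ tt) (Kept-∈-++ q m₂ tt))

lemma4 : (A Y : Cantor → Set) → Extensional A → Extensional Y → Countable Y →
    (p q r : List Sentence) → InP A p → InPY A Y q →
    (∀ s → s ∈ r ⇔ (s ∈ p × Kept Y s)) →
    Compatible A p q ⇔ Compatible A r q
lemma4 A Y _ EY _ p q r hp hq r⇔ =
  mk⇔ (InP-⊆ (++⁺ˡ q (r⊆p r⇔))) (Compatible-restore r⇔ EY hp hq)
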